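{- Let $q$ be even and let $\Pi_q$ be a projective plane of order $q$ whose dual plane contains a hyperoval. If $r=\frac{q}{2}+2$, then $M_r(\Pi_q)=(q+1)(r-1)$.
   Context: A finite projective plane $\Pi_q$ of order $q\ge 2$ has $q^2+q+1$ points and $q^2+q+1$ lines; every line contains $q+1$ points, every point lies on $q+1$ lines, any two lines meet in exactly one point and any two points lie on exactly one line. The dual plane has the lines of $\Pi_q$ as points and the points of $\Pi_q$ as lines, with the same incidences. A hyperoval is a set of $q+2$ points no three of which are collinear. $r$-neighbor line percolation: for a set $A$ of points let $A^0=A$ and for $s\ge1$ let $A^s=A^{s-1}\cup\{P: \exists \text{ line } l\ni P \text{ with } |l\cap A^{s-1}|\ge r\}$; $A$ percolates if $A^k$ equals the whole point set for some $k$. $M_r(\Pi_q)$ is the maximum size of a set of points that does not percolate. -}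

module Defs where

open import Data.Nat using (ℕ; zero; suc; _+_; _*_; _≤_; _≤ᵇ_)
open import Data.Bool using (Bool; true; false; _∧_; _∨_; T)
open import Data.Fin using (Fin)
open import Data.Fin.Subset using (Subset; ∣_∣; ⊤)
open import Data.Vec using (lookup; tabulate)
open import Data.Product using (∃; _×_)
open import Relation.Binary.PropositionalEquality using (_≡_; _≢_)
open import Relation.Nullary using (¬_)
open import Function using (_∘_)

size : ℕ → ℕ
size q = q * q + q + 1

record ProjectivePlane (q : ℕ) : Set where
  field
    incident : Fin (size q) → Fin (size q) → Bool
    line-size  : ∀ l → ∣ tabulate (λ P → incident P l) ∣ ≡ q + 1
    point-deg  : ∀ P → ∣ tabulate (λ l → incident P l) ∣ ≡ q + 1
    lines-meet : ∀ l m → l ≢ m → ∣ tabulate (λ P → incident P l ∧ incident P m) ∣ ≡ 1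
    points-join : ∀ P Q → P ≢ Q → ∣ tabulate (λ l → incident P l ∧ incident Q l) ∣ ≡ 1

module _ {q : ℕ} (Π : ProjectivePlane q) where
  open ProjectivePlane Π

  -- A hyperoval in the dual plane: a set H of q+2 lines of Π (points of the
  -- dual) no three of which are collinear in the dual, i.e. no three distinct
  -- lines of H pass through a common point of Π.
  DualHyperoval : Subset (size q) → Set
  DualHyperoval H =
    ∣ H ∣ ≡ q + 2 ×
    (∀ l₁ l₂ l₃ → T (lookup H l₁) → T (lookup H l₂) → T (lookup H l₃) →
       l₁ ≢ l₂ → l₁ ≢ l₃ → l₂ ≢ l₃ →
       ∀ P → ¬ T (incident P l₁ ∧ incident P l₂ ∧ incident P l₃))

  onLine : Subset (size q) → Fin (size q) → ℕ
  onLine A l = ∣ tabulate (λ P → lookup A P ∧ incident P l) ∣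

  anyLine : (r : ℕ) → Subset (size q) → Fin (size q) → Bool
  anyLine r A P = go (tabulate (λ l → incident P l ∧ (r ≤ᵇ onLine A l)))
    where
      go : ∀ {n} → Subset n → Bool
      go v = Data.Vec.foldr _ _∨_ false v

  step : ℕ → Subset (size q) → Subset (size q)
  step r A = tabulate (λ P → lookup A P ∨ anyLine r A P)

  iter : ℕ → ℕ → Subset (size q) → Subset (size q)
  iter r zero    A = A
  iter r (suc k) A = step r (iter r k A)

  Percolates : ℕ → Subset (size q) → Set
  Percolates r A = ∃ λ k → iter r k A ≡ ⊤

  IsMaxNonPercolating : ℕ → ℕ → Set
  IsMaxNonPercolating r m =
    (∃ λ A → ¬ Percolates r A × ∣ A ∣ ≡ m) ×
    (∀ A → ¬ Percolates r A → ∣ A ∣ ≤ m)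

module Submission where

-- Upper bound: if |A| > (q + 1)(r - 1), the q + 1 lines through a point P outside A partition A,
-- so one of them carries at least r points of A; hence A spans every point in a single step.
-- Lower bound: each point lies on 0 or 2 of the q + 2 lines of a dual hyperoval H (at most 2 by
-- the hyperoval property, and the q + 1 points of a line of H have 2(q + 1) incidences with H).
-- The (q + 2)(q + 1)/2 covered points form a closed set: a line outside H meets the lines of H
-- in (q + 2)/2 = r - 1 covered points, and every line through an uncovered point is outside H.

open import Defs
open import Data.Nat using (ℕ; _+_; _*_; _∸_; _≤_; ⌊_/2⌋)
open import Data.Nat.Divisibility using (_∣_)
open import Data.Fin.Subset using (Subset)
open import Data.Product using (∃)
open import Relation.Binary.PropositionalEquality using (_≡_)

open import Data.Nat using (zero; suc; _<_; _≤ᵇ_; z≤n; s≤s; z<s)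
open import Data.Nat.Properties hiding (suc-injective)
open import Data.Nat.Divisibility using (divides)
open import Data.Nat.Tactic.RingSolver using (solve-∀)
open import Data.Fin using (Fin; zero; suc; punchIn)
open import Data.Fin.Properties using (punchInᵢ≢i; suc-injective)
open import Data.Fin.Subset using (∣_∣; ⊤)
open import Data.Fin.Subset.Properties using (∣⊤∣≡n)
open import Data.Vec using (Vec; _∷_; lookup; tabulate; foldr′)
open import Data.Vec.Properties using (lookup∘tabulate; tabulate∘lookup; tabulate-cong; lookup-replicate)
open import Data.Bool using (Bool; true; false; _∧_; _∨_; T)
open import Data.Bool.Properties using (T-≡; T-∧; T-∨; ∧-idem)
open import Data.Empty using (⊥)
open import Data.Sum using (inj₁; inj₂)
open import Data.Product using (_×_; _,_; proj₁; proj₂)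
open import Function using (_∘_; Equivalence)
open import Relation.Binary.PropositionalEquality
  using (_≢_; refl; sym; trans; cong; cong₂; subst; module ≡-Reasoning)
open import Relation.Nullary using (¬_; contradiction)
open import Algebra.Properties.Semiring.Sum +-*-semiring
  using (sum; sum-syntax; sum-cong-≗; sum-remove; ∑-comm; *-distribˡ-sum; *-distribʳ-sum)

open Equivalence using (to; from)

⟦_⟧ : Bool → ℕ
⟦ true ⟧  = 1
⟦ false ⟧ = 0

⟦∧⟧ : ∀ a b → ⟦ a ∧ b ⟧ ≡ ⟦ a ⟧ * ⟦ b ⟧
⟦∧⟧ true  b = sym (+-identityʳ ⟦ b ⟧)
⟦∧⟧ false b = refl

⟦⟧-T : ∀ {b} → T b → ⟦ b ⟧ ≡ 1
⟦⟧-T {true} _ = refl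

⟦⟧-¬T : ∀ {b} → ¬ T b → ⟦ b ⟧ ≡ 0
⟦⟧-¬T {true}  ¬b = contradiction _ ¬b
⟦⟧-¬T {false} _  = refl

∣tabulate∣≡∑ : ∀ {n} (b : Fin n → Bool) → ∣ tabulate b ∣ ≡ ∑[ i < n ] ⟦ b i ⟧
∣tabulate∣≡∑ {zero}  b = refl
∣tabulate∣≡∑ {suc n} b with b zero
... | true  = cong suc (∣tabulate∣≡∑ (b ∘ suc))
... | false = ∣tabulate∣≡∑ (b ∘ suc)

∣∣≡∑ : ∀ {n} (A : Subset n) → ∣ A ∣ ≡ ∑[ i < n ] ⟦ lookup A i ⟧
∣∣≡∑ A = trans (cong ∣_∣ (sym (tabulate∘lookup A))) (∣tabulate∣≡∑ (lookup A))

∑-mono-≤ : ∀ {n} {f g : Fin n → ℕ} → (∀ i → f i ≤ g i) → sum f ≤ sum g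
∑-mono-≤ {zero}  f≤g = z≤n
∑-mono-≤ {suc n} f≤g = +-mono-≤ (f≤g zero) (∑-mono-≤ (f≤g ∘ suc))

∑-mono-≤-≡⇒≗ : ∀ {n} {f g : Fin n → ℕ} → (∀ i → f i ≤ g i) → sum f ≡ sum g →
  ∀ i → f i ≡ g i
∑-mono-≤-≡⇒≗ {suc n} {f} {g} f≤g ∑f≡∑g i = go i
  where
  f₀≡g₀ : f zero ≡ g zero
  f₀≡g₀ = ≤-antisym (f≤g zero) (+-cancelʳ-≤ (sum (f ∘ suc)) (g zero) (f zero)
    (≤-trans (+-monoʳ-≤ (g zero) (∑-mono-≤ (f≤g ∘ suc))) (≤-reflexive (sym ∑f≡∑g))))
  go : ∀ i → f i ≡ g i
  go zero    = f₀≡g₀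
  go (suc i) = ∑-mono-≤-≡⇒≗ (f≤g ∘ suc)
    (+-cancelˡ-≡ (f zero) _ _ (trans ∑f≡∑g (cong (_+ sum (g ∘ suc)) (sym f₀≡g₀)))) i

∑-except : ∀ {n} {f g : Fin n → ℕ} (a : Fin n) → (∀ i → i ≢ a → f i ≡ g i) →
  sum f + g a ≡ sum g + f a
∑-except {suc n} {f} {g} a f≡g = begin
  sum f + g a                              ≡⟨ cong (_+ g a) (sum-remove f) ⟩
  f a + sum (f ∘ punchIn a) + g a          ≡⟨ cong (λ s → f a + s + g a) off-a ⟩
  f a + sum (g ∘ punchIn a) + g a          ≡⟨ solve (f a) (sum (g ∘ punchIn a)) (g a) ⟩
  g a + sum (g ∘ punchIn a) + f a          ≡⟨ cong (_+ f a) (sym (sum-remove g)) ⟩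
  sum g + f a                              ∎
  where
  open ≡-Reasoning
  off-a : sum (f ∘ punchIn a) ≡ sum (g ∘ punchIn a)
  off-a = sum-cong-≗ (λ j → f≡g (punchIn a j) (punchInᵢ≢i a j))
  solve : ∀ x s y → x + s + y ≡ y + s + x
  solve = solve-∀

∑⟦⟧-positive : ∀ {n} (b : Fin n → Bool) → 0 < ∑[ i < n ] ⟦ b i ⟧ → ∃ λ i → T (b i)
∑⟦⟧-positive {suc n} b pos with b zero in e
... | true  = zero , from T-≡ e
... | false with ∑⟦⟧-positive (b ∘ suc) pos
...   | i , bi = suc i , bi

∑⟦⟧≤1 : ∀ {n} (b : Fin n → Bool) → (∀ i j → T (b i) → T (b j) → i ≢ j → ⊥) →
  ∑[ i < n ] ⟦ b i ⟧ ≤ 1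
∑⟦⟧≤1 {zero}  b no-two = z≤n
∑⟦⟧≤1 {suc n} b no-two with b zero in e
... | true  = s≤s (≮⇒≥ λ pos → let (i , bi) = ∑⟦⟧-positive (b ∘ suc) pos in
                                no-two zero (suc i) (from T-≡ e) bi λ ())
... | false = ∑⟦⟧≤1 (b ∘ suc) λ i j bi bj i≢j → no-two (suc i) (suc j) bi bj (i≢j ∘ suc-injective)

∑⟦⟧≤2 : ∀ {n} (b : Fin n → Bool) →
  (∀ i j k → T (b i) → T (b j) → T (b k) → i ≢ j → i ≢ k → j ≢ k → ⊥) →
  ∑[ i < n ] ⟦ b i ⟧ ≤ 2
∑⟦⟧≤2 {zero}  b no-three = z≤n
∑⟦⟧≤2 {suc n} b no-three with b zero in e
... | true  = s≤s (∑⟦⟧≤1 (b ∘ suc) λ i j bi bj i≢j →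
                no-three zero (suc i) (suc j) (from T-≡ e) bi bj (λ ()) (λ ()) (i≢j ∘ suc-injective))
... | false = ∑⟦⟧≤2 (b ∘ suc) λ i j k bi bj bk i≢j i≢k j≢k →
                no-three (suc i) (suc j) (suc k) bi bj bk
                  (i≢j ∘ suc-injective) (i≢k ∘ suc-injective) (j≢k ∘ suc-injective)

-- Both sides count the pairs (i , j) with u i, v j and R i j.
∑⟦⟧-double-count : ∀ {m n} (u : Fin m → Bool) (v : Fin n → Bool) (R : Fin m → Fin n → Bool) →
  ∑[ i < m ] (⟦ u i ⟧ * ∑[ j < n ] ⟦ v j ∧ R i j ⟧) ≡
  ∑[ j < n ] (⟦ v j ⟧ * ∑[ i < m ] ⟦ u i ∧ R i j ⟧)
∑⟦⟧-double-count {m} {n} u v R = begin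
  ∑[ i < m ] (⟦ u i ⟧ * ∑[ j < n ] ⟦ v j ∧ R i j ⟧)
    ≡⟨ sum-cong-≗ (λ i → *-distribˡ-sum ⟦ u i ⟧ (λ j → ⟦ v j ∧ R i j ⟧)) ⟩
  ∑[ i < m ] ∑[ j < n ] (⟦ u i ⟧ * ⟦ v j ∧ R i j ⟧)
    ≡⟨ ∑-comm (λ i j → ⟦ u i ⟧ * ⟦ v j ∧ R i j ⟧) ⟩
  ∑[ j < n ] ∑[ i < m ] (⟦ u i ⟧ * ⟦ v j ∧ R i j ⟧)
    ≡⟨ sum-cong-≗ (λ j → sum-cong-≗ (λ i → swap (u i) (v j) (R i j))) ⟩
  ∑[ j < n ] ∑[ i < m ] (⟦ v j ⟧ * ⟦ u i ∧ R i j ⟧)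
    ≡⟨ sum-cong-≗ (λ j → sym (*-distribˡ-sum ⟦ v j ⟧ (λ i → ⟦ u i ∧ R i j ⟧))) ⟩
  ∑[ j < n ] (⟦ v j ⟧ * ∑[ i < m ] ⟦ u i ∧ R i j ⟧)
    ∎
  where
  open ≡-Reasoning
  swap : ∀ a b c → ⟦ a ⟧ * ⟦ b ∧ c ⟧ ≡ ⟦ b ⟧ * ⟦ a ∧ c ⟧
  swap true  true  c = refl
  swap true  false c = refl
  swap false true  c = refl
  swap false false c = refl

T-or⁺ : ∀ {n} (v : Vec Bool n) i → T (lookup v i) → T (foldr′ _∨_ false v)
T-or⁺ (x ∷ v) zero    t = from T-∨ (inj₁ t)
T-or⁺ (x ∷ v) (suc i) t = from T-∨ (inj₂ (T-or⁺ v i t))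

T-or⁻ : ∀ {n} (v : Vec Bool n) → T (foldr′ _∨_ false v) → ∃ λ i → T (lookup v i)
T-or⁻ (x ∷ v) t with to T-∨ t
... | inj₁ tx = zero , tx
... | inj₂ tv with T-or⁻ v tv
...   | i , ti = suc i , ti

⌊n*2/2⌋≡n : ∀ n → ⌊ n * 2 /2⌋ ≡ n
⌊n*2/2⌋≡n zero    = refl
⌊n*2/2⌋≡n (suc n) = cong suc (⌊n*2/2⌋≡n n)

size*2≢ : ∀ q → 2 ≤ q → size q * 2 ≢ (q + 2) * (q + 1)
size*2≢ (suc (suc p)) (s≤s (s≤s _)) eq = <-irrefl (sym eq) (subst ((2 + p + 2) * (2 + p + 1) <_) (sym (surplus p)) (m<m+n _ z<s))
  where
  surplus : ∀ p → ((2 + p) * (2 + p) + (2 + p) + 1) * 2 ≡ (2 + p + 2) * (2 + p + 1) + (1 + p) * (2 + p)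
  surplus = solve-∀

module _ {q : ℕ} (Π : ProjectivePlane q) where
  open ProjectivePlane Π

  private
    Point Line : Set
    Point = Fin (size q)
    Line  = Fin (size q)

  ∑-points-on : ∀ l → ∑[ P < size q ] ⟦ incident P l ⟧ ≡ q + 1
  ∑-points-on l = trans (sym (∣tabulate∣≡∑ (λ P → incident P l))) (line-size l)

  ∑-lines-through : ∀ P → ∑[ l < size q ] ⟦ incident P l ⟧ ≡ q + 1
  ∑-lines-through P = trans (sym (∣tabulate∣≡∑ (incident P))) (point-deg P)

  ∑-common-points : ∀ l m → l ≢ m → ∑[ P < size q ] ⟦ incident P l ∧ incident P m ⟧ ≡ 1
  ∑-common-points l m l≢m = trans (sym (∣tabulate∣≡∑ (λ P → incident P l ∧ incident P m))) (lines-meet l m l≢m)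

  ∑-common-lines : ∀ P Q → P ≢ Q → ∑[ l < size q ] ⟦ incident P l ∧ incident Q l ⟧ ≡ 1
  ∑-common-lines P Q P≢Q = trans (sym (∣tabulate∣≡∑ (λ l → incident P l ∧ incident Q l))) (points-join P Q P≢Q)

  onLine≡∑ : ∀ A l → onLine Π A l ≡ ∑[ P < size q ] ⟦ lookup A P ∧ incident P l ⟧
  onLine≡∑ A l = ∣tabulate∣≡∑ (λ P → lookup A P ∧ incident P l)

  -- Each point of X other than P lies on exactly one line through P.
  ∣∣≡∑-onLine-through : ∀ X P → ¬ T (lookup X P) →
    ∣ X ∣ ≡ ∑[ l < size q ] (⟦ incident P l ⟧ * onLine Π X l)
  ∣∣≡∑-onLine-through X P P∉X = begin
    ∣ X ∣
      ≡⟨ ∣∣≡∑ X ⟩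
    ∑[ Q < size q ] ⟦ lookup X Q ⟧
      ≡⟨ sum-cong-≗ one-line-to-P ⟨
    ∑[ Q < size q ] (⟦ lookup X Q ⟧ * ∑[ l < size q ] ⟦ incident P l ∧ incident Q l ⟧)
      ≡⟨ ∑⟦⟧-double-count (incident P) (lookup X) (λ l Q → incident Q l) ⟨
    ∑[ l < size q ] (⟦ incident P l ⟧ * ∑[ Q < size q ] ⟦ lookup X Q ∧ incident Q l ⟧)
      ≡⟨ sum-cong-≗ (λ l → cong (⟦ incident P l ⟧ *_) (onLine≡∑ X l)) ⟨
    ∑[ l < size q ] (⟦ incident P l ⟧ * onLine Π X l)
      ∎
    where
    open ≡-Reasoning
    one-line-to-P : ∀ Q → ⟦ lookup X Q ⟧ * ∑[ l < size q ] ⟦ incident P l ∧ incident Q l ⟧ ≡ ⟦ lookup X Q ⟧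
    one-line-to-P Q with lookup X Q in Q∈X
    ... | false = refl
    ... | true  = trans (+-identityʳ _) (∑-common-lines P Q P≢Q)
      where
      P≢Q : P ≢ Q
      P≢Q refl = P∉X (from T-≡ Q∈X)

  ∣∣≤-sparse-pencil : ∀ X P k → ¬ T (lookup X P) →
    (∀ l → T (incident P l) → onLine Π X l ≤ k) → ∣ X ∣ ≤ (q + 1) * k
  ∣∣≤-sparse-pencil X P k P∉X sparse = begin
    ∣ X ∣                                                 ≡⟨ ∣∣≡∑-onLine-through X P P∉X ⟩
    ∑[ l < size q ] (⟦ incident P l ⟧ * onLine Π X l)     ≤⟨ ∑-mono-≤ bound ⟩
    ∑[ l < size q ] (⟦ incident P l ⟧ * k)                ≡⟨ *-distribʳ-sum k (λ l → ⟦ incident P l ⟧) ⟨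
    (∑[ l < size q ] ⟦ incident P l ⟧) * k                ≡⟨ cong (_* k) (∑-lines-through P) ⟩
    (q + 1) * k                                           ∎
    where
    open ≤-Reasoning
    bound : ∀ l → ⟦ incident P l ⟧ * onLine Π X l ≤ ⟦ incident P l ⟧ * k
    bound l with incident P l in P∈l
    ... | false = z≤n
    ... | true  = +-monoˡ-≤ 0 (sparse l (from T-≡ P∈l))

  private
    rich-lines : ℕ → Subset (size q) → Point → Vec Bool (size q)
    rich-lines r A P = tabulate (λ l → incident P l ∧ (r ≤ᵇ onLine Π A l))

  anyLine⁺ : ∀ r A P l → T (incident P l) → r ≤ onLine Π A l → T (anyLine Π r A P)
  anyLine⁺ r A P l P∈l r≤ = T-or⁺ (rich-lines r A P) l
    (subst T (sym (lookup∘tabulate _ l)) (from T-∧ (P∈l , ≤⇒≤ᵇ r≤)))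

  anyLine⁻ : ∀ r A P → T (anyLine Π r A P) → ∃ λ l → T (incident P l) × r ≤ onLine Π A l
  anyLine⁻ r A P t with T-or⁻ (rich-lines r A P) t
  ... | l , tl with to T-∧ (subst T (lookup∘tabulate _ l) tl)
  ...   | P∈l , r≤ = l , P∈l , ≤ᵇ⇒≤ r _ r≤

  step-⊤ : ∀ A k → (q + 1) * k < ∣ A ∣ → step Π (suc k) A ≡ ⊤
  step-⊤ A k big = begin
    step Π (suc k) A      ≡⟨ tabulate-cong spanned ⟩
    tabulate (lookup ⊤)   ≡⟨ tabulate∘lookup ⊤ ⟩
    ⊤                     ∎
    where
    open ≡-Reasoning
    spanned : ∀ P → (lookup A P ∨ anyLine Π (suc k) A P) ≡ lookup ⊤ P
    spanned P rewrite lookup-replicate {n = size q} P true with lookup A P in P∈A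
    ... | true  = refl
    ... | false with anyLine Π (suc k) A P in rich
    ...   | true  = refl
    ...   | false = contradiction big (≤⇒≯ (∣∣≤-sparse-pencil A P k (λ t → subst T P∈A t) sparse))
      where
      sparse : ∀ l → T (incident P l) → onLine Π A l ≤ k
      sparse l P∈l = ≮⇒≥ λ k<A∩l → subst T rich (anyLine⁺ (suc k) A P l P∈l k<A∩l)

  ¬Percolates⇒∣∣≤ : ∀ A k → ¬ Percolates Π (suc k) A → ∣ A ∣ ≤ (q + 1) * k
  ¬Percolates⇒∣∣≤ A k ¬perc = ≮⇒≥ λ big → ¬perc (1 , step-⊤ A k big)

  step-closed : ∀ r C → (∀ P → ¬ T (lookup C P) → ∀ l → T (incident P l) → onLine Π C l < r) →
    step Π r C ≡ C
  step-closed r C sparse = trans (tabulate-cong closed) (tabulate∘lookup C)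
    where
    closed : ∀ P → (lookup C P ∨ anyLine Π r C P) ≡ lookup C P
    closed P with lookup C P in P∈C
    ... | true  = refl
    ... | false with anyLine Π r C P in rich
    ...   | false = refl
    ...   | true with anyLine⁻ r C P (from T-≡ rich)
    ...     | l , P∈l , r≤C∩l = contradiction r≤C∩l (<⇒≱ (sparse P (λ t → subst T P∈C t) l P∈l))

  iter-closed : ∀ r C → step Π r C ≡ C → ∀ j → iter Π r j C ≡ C
  iter-closed r C closed zero    = refl
  iter-closed r C closed (suc j) = trans (cong (step Π r) (iter-closed r C closed j)) closed

  closed⇒¬Percolates : ∀ r C → step Π r C ≡ C → C ≢ ⊤ → ¬ Percolates Π r C
  closed⇒¬Percolates r C closed C≢⊤ (j , C^j≡⊤) = C≢⊤ (trans (sym (iter-closed r C closed j)) C^j≡⊤)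

  module CoveredPoints (H : Subset (size q)) (hyperoval : DualHyperoval Π H) where

    degree : Point → ℕ
    degree P = ∑[ l < size q ] ⟦ lookup H l ∧ incident P l ⟧

    degree-along : Line → ℕ
    degree-along a = ∑[ P < size q ] (⟦ incident P a ⟧ * degree P)

    degree≤2 : ∀ P → degree P ≤ 2
    degree≤2 P = ∑⟦⟧≤2 (λ l → lookup H l ∧ incident P l)
      λ l₁ l₂ l₃ t₁ t₂ t₃ l₁≢l₂ l₁≢l₃ l₂≢l₃ →
        let (l₁∈H , P∈l₁) = to T-∧ t₁
            (l₂∈H , P∈l₂) = to T-∧ t₂
            (l₃∈H , P∈l₃) = to T-∧ t₃
        in proj₂ hyperoval l₁ l₂ l₃ l₁∈H l₂∈H l₃∈H l₁≢l₂ l₁≢l₃ l₂≢l₃ P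
             (from T-∧ (P∈l₁ , from T-∧ (P∈l₂ , P∈l₃)))

    -- Double counting the pairs (P , l) with P on a and l ∈ H: every line of H other than a meets a once.
    degree-along-≡ : ∀ a →
      degree-along a + ⟦ lookup H a ⟧ ≡ q + 2 + ⟦ lookup H a ⟧ * (q + 1)
    degree-along-≡ a = begin
      degree-along a + ⟦ lookup H a ⟧
        ≡⟨ cong (_+ ⟦ lookup H a ⟧) (∑⟦⟧-double-count (λ P → incident P a) (lookup H) incident) ⟩
      ∑[ l < size q ] (⟦ lookup H l ⟧ * ∑[ P < size q ] ⟦ incident P a ∧ incident P l ⟧) + ⟦ lookup H a ⟧
        ≡⟨ ∑-except a meets-a-once ⟩
      ∑[ l < size q ] ⟦ lookup H l ⟧ + ⟦ lookup H a ⟧ * ∑[ P < size q ] ⟦ incident P a ∧ incident P a ⟧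
        ≡⟨ cong₂ _+_ (trans (sym (∣∣≡∑ H)) (proj₁ hyperoval)) (cong (⟦ lookup H a ⟧ *_) points-on-a) ⟩
      q + 2 + ⟦ lookup H a ⟧ * (q + 1)
        ∎
      where
      open ≡-Reasoning
      meets-a-once : ∀ l → l ≢ a →
        ⟦ lookup H l ⟧ * ∑[ P < size q ] ⟦ incident P a ∧ incident P l ⟧ ≡ ⟦ lookup H l ⟧
      meets-a-once l l≢a =
        trans (cong (⟦ lookup H l ⟧ *_) (∑-common-points a l (l≢a ∘ sym))) (*-identityʳ _)
      points-on-a : ∑[ P < size q ] ⟦ incident P a ∧ incident P a ⟧ ≡ q + 1
      points-on-a = trans (sum-cong-≗ (λ P → cong ⟦_⟧ (∧-idem (incident P a)))) (∑-points-on a)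

    degree-along-H-line : ∀ a → T (lookup H a) → degree-along a ≡ (q + 1) * 2
    degree-along-H-line a a∈H = +-cancelʳ-≡ 1 _ _ (begin
      degree-along a + 1
        ≡⟨ cong (degree-along a +_) (sym (⟦⟧-T a∈H)) ⟩
      degree-along a + ⟦ lookup H a ⟧
        ≡⟨ degree-along-≡ a ⟩
      q + 2 + ⟦ lookup H a ⟧ * (q + 1)
        ≡⟨ cong (λ x → q + 2 + x * (q + 1)) (⟦⟧-T a∈H) ⟩
      q + 2 + 1 * (q + 1)
        ≡⟨ arith q ⟩
      (q + 1) * 2 + 1
        ∎)
      where
      open ≡-Reasoning
      arith : ∀ q → q + 2 + 1 * (q + 1) ≡ (q + 1) * 2 + 1
      arith = solve-∀

    degree-along-other-line : ∀ a → ¬ T (lookup H a) → degree-along a ≡ q + 2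
    degree-along-other-line a a∉H = +-cancelʳ-≡ 0 _ _ (begin
      degree-along a + 0
        ≡⟨ cong (degree-along a +_) (sym (⟦⟧-¬T a∉H)) ⟩
      degree-along a + ⟦ lookup H a ⟧
        ≡⟨ degree-along-≡ a ⟩
      q + 2 + ⟦ lookup H a ⟧ * (q + 1)
        ≡⟨ cong (λ x → q + 2 + x * (q + 1)) (⟦⟧-¬T a∉H) ⟩
      q + 2 + 0
        ∎)
      where open ≡-Reasoning

    -- The q + 1 points of a line of H have degree at most 2 and total degree 2 (q + 1).
    degree-on-H-line : ∀ a P → T (lookup H a) → T (incident P a) → degree P ≡ 2
    degree-on-H-line a P a∈H P∈a = begin
      degree P                        ≡⟨ +-identityʳ (degree P) ⟨
      1 * degree P                    ≡⟨ cong (_* degree P) (⟦⟧-T P∈a) ⟨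
      ⟦ incident P a ⟧ * degree P     ≡⟨ tight P ⟩
      ⟦ incident P a ⟧ * 2            ≡⟨ cong (_* 2) (⟦⟧-T P∈a) ⟩
      2                               ∎
      where
      open ≡-Reasoning
      tight : ∀ Q → ⟦ incident Q a ⟧ * degree Q ≡ ⟦ incident Q a ⟧ * 2
      tight = ∑-mono-≤-≡⇒≗ (λ Q → *-monoʳ-≤ ⟦ incident Q a ⟧ (degree≤2 Q))
        (trans (degree-along-H-line a a∈H)
          (trans (cong (_* 2) (sym (∑-points-on a))) (*-distribʳ-sum 2 (λ Q → ⟦ incident Q a ⟧))))

    covered : Subset (size q)
    covered = tabulate (λ P → 1 ≤ᵇ degree P)

    ⟦covered⟧*2≡degree : ∀ P → ⟦ lookup covered P ⟧ * 2 ≡ degree P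
    ⟦covered⟧*2≡degree P rewrite lookup∘tabulate (λ P → 1 ≤ᵇ degree P) P with degree P in d
    ... | zero  = refl
    ... | suc _ with ∑⟦⟧-positive (λ l → lookup H l ∧ incident P l) (subst (0 <_) (sym d) z<s)
    ...   | a , t = let (a∈H , P∈a) = to T-∧ t in trans (sym (degree-on-H-line a P a∈H P∈a)) d

    ∣covered∣*2 : ∣ covered ∣ * 2 ≡ (q + 2) * (q + 1)
    ∣covered∣*2 = begin
      ∣ covered ∣ * 2
        ≡⟨ cong (_* 2) (∣∣≡∑ covered) ⟩
      (∑[ P < size q ] ⟦ lookup covered P ⟧) * 2
        ≡⟨ *-distribʳ-sum 2 (λ P → ⟦ lookup covered P ⟧) ⟩
      ∑[ P < size q ] (⟦ lookup covered P ⟧ * 2)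
        ≡⟨ sum-cong-≗ ⟦covered⟧*2≡degree ⟩
      ∑[ P < size q ] degree P
        ≡⟨ ∑-comm (λ P l → ⟦ lookup H l ∧ incident P l ⟧) ⟩
      ∑[ l < size q ] ∑[ P < size q ] ⟦ lookup H l ∧ incident P l ⟧
        ≡⟨ sum-cong-≗ (λ l → trans (sum-cong-≗ (λ P → ⟦∧⟧ (lookup H l) (incident P l)))
                                   (sym (*-distribˡ-sum ⟦ lookup H l ⟧ (λ P → ⟦ incident P l ⟧)))) ⟩
      ∑[ l < size q ] (⟦ lookup H l ⟧ * ∑[ P < size q ] ⟦ incident P l ⟧)
        ≡⟨ sum-cong-≗ (λ l → cong (⟦ lookup H l ⟧ *_) (∑-points-on l)) ⟩
      ∑[ l < size q ] (⟦ lookup H l ⟧ * (q + 1))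
        ≡⟨ *-distribʳ-sum (q + 1) (λ l → ⟦ lookup H l ⟧) ⟨
      (∑[ l < size q ] ⟦ lookup H l ⟧) * (q + 1)
        ≡⟨ cong (_* (q + 1)) (trans (sym (∣∣≡∑ H)) (proj₁ hyperoval)) ⟩
      (q + 2) * (q + 1)
        ∎
      where open ≡-Reasoning

    covered≢⊤ : 2 ≤ q → covered ≢ ⊤
    covered≢⊤ 2≤q covered≡⊤ = size*2≢ q 2≤q (begin
      size q * 2            ≡⟨ cong (_* 2) (∣⊤∣≡n (size q)) ⟨
      ∣ ⊤ {size q} ∣ * 2    ≡⟨ cong (λ C → ∣ C ∣ * 2) covered≡⊤ ⟨
      ∣ covered ∣ * 2       ≡⟨ ∣covered∣*2 ⟩
      (q + 2) * (q + 1)     ∎)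
      where open ≡-Reasoning

    onLine-covered*2 : ∀ a → ¬ T (lookup H a) → onLine Π covered a * 2 ≡ q + 2
    onLine-covered*2 a a∉H = begin
      onLine Π covered a * 2
        ≡⟨ cong (_* 2) (onLine≡∑ covered a) ⟩
      (∑[ P < size q ] ⟦ lookup covered P ∧ incident P a ⟧) * 2
        ≡⟨ *-distribʳ-sum 2 (λ P → ⟦ lookup covered P ∧ incident P a ⟧) ⟩
      ∑[ P < size q ] (⟦ lookup covered P ∧ incident P a ⟧ * 2)
        ≡⟨ sum-cong-≗ counted-twice ⟩
      degree-along a
        ≡⟨ degree-along-other-line a a∉H ⟩
      q + 2
        ∎
      where
      open ≡-Reasoning
      swap : ∀ x y → x * y * 2 ≡ y * (x * 2)
      swap = solve-∀
      counted-twice : ∀ P → ⟦ lookup covered P ∧ incident P a ⟧ * 2 ≡ ⟦ incident P a ⟧ * degree P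
      counted-twice P = begin
        ⟦ lookup covered P ∧ incident P a ⟧ * 2           ≡⟨ cong (_* 2) (⟦∧⟧ (lookup covered P) (incident P a)) ⟩
        ⟦ lookup covered P ⟧ * ⟦ incident P a ⟧ * 2       ≡⟨ swap ⟦ lookup covered P ⟧ ⟦ incident P a ⟧ ⟩
        ⟦ incident P a ⟧ * (⟦ lookup covered P ⟧ * 2)     ≡⟨ cong (⟦ incident P a ⟧ *_) (⟦covered⟧*2≡degree P) ⟩
        ⟦ incident P a ⟧ * degree P                       ∎

    -- An uncovered point lies on no line of H, so each line through it carries (q + 2) / 2 covered points.
    covered-closed : ∀ r → q + 2 < r * 2 → step Π r covered ≡ covered
    covered-closed r q+2<2r = step-closed r covered sparse
      where
      sparse : ∀ P → ¬ T (lookup covered P) → ∀ l → T (incident P l) → onLine Π covered l < r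
      sparse P P∉C l P∈l = *-cancelʳ-< 2 _ r (subst (_< r * 2) (sym (onLine-covered*2 l l∉H)) q+2<2r)
        where
        l∉H : ¬ T (lookup H l)
        l∉H l∈H = contradiction
          (trans (cong (_* 2) (sym (⟦⟧-¬T P∉C))) (trans (⟦covered⟧*2≡degree P) (degree-on-H-line l P l∈H P∈l)))
          λ ()

proposition11 : (q : ℕ) → 2 ≤ q → 2 ∣ q → (Π : ProjectivePlane q) →
    (∃ λ (H : Subset (size q)) → DualHyperoval Π H) →
    (r : ℕ) → r ≡ ⌊ q /2⌋ + 2 →
    IsMaxNonPercolating Π r ((q + 1) * (r ∸ 1))
proposition11 q 2≤q (divides k q≡k*2) Π (H , hyperoval) r r≡⌊q/2⌋+2
  with refl ← trans r≡⌊q/2⌋+2 (cong (λ x → ⌊ x /2⌋ + 2) q≡k*2)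
  rewrite ⌊n*2/2⌋≡n k | +-comm k 2 =
  (covered , covered-¬Percolates , ∣covered∣) , λ A → ¬Percolates⇒∣∣≤ Π A (1 + k)
  where
  open CoveredPoints Π H hyperoval
  q+2≡ : q + 2 ≡ (1 + k) * 2
  q+2≡ = trans (cong (_+ 2) q≡k*2) (+-comm (k * 2) 2)
  q+2<2r : q + 2 < (2 + k) * 2
  q+2<2r = subst (_< (2 + k) * 2) (sym q+2≡) (*-monoˡ-< 2 (n<1+n (1 + k)))
  covered-¬Percolates : ¬ Percolates Π (2 + k) covered
  covered-¬Percolates = closed⇒¬Percolates Π (2 + k) covered (covered-closed (2 + k) q+2<2r) (covered≢⊤ 2≤q)
  ∣covered∣ : ∣ covered ∣ ≡ (q + 1) * (1 + k)
  ∣covered∣ = *-cancelʳ-≡ _ _ 2 (trans ∣covered∣*2 (trans (cong (_* (q + 1)) q+2≡) (arith (1 + k) (q + 1))))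
    where
    arith : ∀ a b → a * 2 * b ≡ b * a * 2
    arith = solve-∀
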